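{- $|M(A_k)|\to\infty$ as $k\to\infty$.
   Context: All posets are finite. A copy of a poset $P$ in a poset $Q$ is a subset of $Q$ which with the induced order is isomorphic to $P$. A coloring of a poset is proper if comparable distinct elements get distinct colors; a copy is rainbow if its elements get pairwise distinct colors. $Q$ rainbow forces $P$ if every proper coloring of $Q$ admits a rainbow copy of $P$. $M(P)$ is the set (up to isomorphism) of posets $Q$ that rainbow force $P$ but such that for every $q\in Q$, $Q\setminus\{q\}$ does not rainbow force $P$. $A_k$ is the antichain on $k$ elements. -}

module Defs where

open import Data.Nat using (ℕ; suc; _≤_)
open import Data.Fin using (Fin; punchIn)
open import Data.Fin.Properties using (punchIn-injective; _≟_)
open import Data.Bool using (Bool; T)
open import Data.Product using (Σ; ∃; _×_; _,_)
open import Relation.Nullary using (¬_; yes; no)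
open import Relation.Nullary.Decidable using (⌊_⌋; toWitness; fromWitness)
open import Relation.Binary.PropositionalEquality using (_≡_; _≢_; refl; trans; sym; cong)

record FinPoset (n : ℕ) : Set where
  field
    le      : Fin n → Fin n → Bool
    reflexive : ∀ x → T (le x x)
    antisym : ∀ x y → T (le x y) → T (le y x) → x ≡ y
    trans′  : ∀ x y z → T (le x y) → T (le y z) → T (le x z)
open FinPoset public

Poset : Set
Poset = Σ ℕ FinPoset

antichain : (k : ℕ) → FinPoset k
antichain k = record
  { le = λ x y → ⌊ x ≟ y ⌋
  ; reflexive = λ x → fromWitness {a? = x ≟ x} refl
  ; antisym = λ x y p _ → toWitness p
  ; trans′ = λ x y z p q → fromWitness (trans (toWitness p) (toWitness q))
  }

A : ℕ → Poset
A k = k , antichain k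

delete : ∀ {m} → FinPoset (suc m) → Fin (suc m) → FinPoset m
delete {m} Q q = record
  { le = λ x y → le Q (punchIn q x) (punchIn q y)
  ; reflexive = λ x → reflexive Q (punchIn q x)
  ; antisym = λ x y p r → punchIn-injective q x y (antisym Q _ _ p r)
  ; trans′ = λ x y z p r → trans′ Q _ _ _ p r
  }

record Copy {p q : ℕ} (P : FinPoset p) (Q : FinPoset q) : Set where
  field
    map      : Fin p → Fin q
    injective : ∀ x y → map x ≡ map y → x ≡ y
    order    : ∀ x y → le P x y ≡ le Q (map x) (map y)
open Copy public

Coloring : ℕ → Set
Coloring n = Fin n → ℕ

Proper : ∀ {n} → FinPoset n → Coloring n → Set
Proper Q c = ∀ x y → x ≢ y → T (le Q x y) → c x ≢ c y

Rainbow : ∀ {p q} {P : FinPoset p} {Q : FinPoset q} → Coloring q → Copy P Q → Set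
Rainbow c C = ∀ x y → x ≢ y → c (map C x) ≢ c (map C y)

RainbowForces : ∀ {q p} → FinPoset q → FinPoset p → Set
RainbowForces {q} {p} Q P =
  (c : Coloring q) → Proper Q c → Σ (Copy P Q) λ C → Rainbow c C

InM : ∀ {p} → FinPoset p → Poset → Set
InM P (0 , Q) = RainbowForces Q P
InM P (suc m , Q) = RainbowForces Q P × (∀ x → ¬ RainbowForces (delete Q x) P)

Iso : Poset → Poset → Set
Iso (n , P) (m , Q) =
  Σ (Fin n → Fin m) λ f → Σ (Fin m → Fin n) λ g →
    (∀ x → g (f x) ≡ x) × (∀ y → f (g y) ≡ y) × (∀ x y → le P x y ≡ le Q (f x) (f y))

AtLeast : ℕ → (Poset → Set) → Set
AtLeast N S = Σ (Fin N → Poset) λ F → (∀ i → S (F i)) × (∀ i j → i ≢ j → ¬ Iso (F i) (F j))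

{-# OPTIONS --safe #-}

-- Let S_p be the disjoint union of the chains of lengths 1, …, p with a core made of chains
-- E, D of p + 1 elements, Y of p + 2 and X of p + 3 elements, in which the bottom of X lies
-- below all of D and all of E lie below the top of X.  Under a proper colouring the chains
-- contain a rainbow A_p, and the core always offers one element of Y and two incomparable
-- elements of E, D, X whose three colours avoid those p colours; so S_p rainbow forces
-- A_(p+3).  For every element t, colouring the chains by their levels, closed up around t
-- and suitably shifted, leaves every rainbow antichain of S_p - t with at most p + 2
-- elements.  Adjoining disjoint chains of lengths p + 4, …, k keeps both properties, since
-- a rainbow antichain meets a chain at most once and S_p has a proper colouring with p + 3
-- colours.  The resulting member of M(A_k) has triangle k + p + 1 elements, so the values
-- p < N give N pairwise non-isomorphic members as soon as k ≥ N + 2.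

module Submission where

open import Defs
open import Data.Nat using (ℕ; _≤_)
open import Data.Product using (Σ)

open import Data.Bool using (true; false; T)
open import Data.Empty using (⊥; ⊥-elim)
open import Data.Fin as Fin using (Fin; zero; suc; toℕ; fromℕ; fromℕ<; punchIn; punchOut; splitAt)
open import Data.Fin.Properties as Fin
  using (+↔⊎; toℕ<n; toℕ-fromℕ; toℕ-fromℕ<; toℕ-injective; punchIn-injective; punchInᵢ≢i;
         punchOut-injective; all?; any?; ¬∀⟶∃¬; join-splitAt)
open import Data.Nat as ℕ using (zero; suc; _+_; _∸_; _<_; z≤n; s≤s)
open import Data.Nat.Properties as ℕ using ()
open import Data.Nat.Tactic.RingSolver using (solve-∀)
open import Data.Product using (_×_; _,_; proj₁; proj₂; ∃)
open import Data.Sum using (_⊎_; inj₁; inj₂; [_,_])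
open import Data.Sum.Function.Propositional using (_⊎-↔_)
open import Data.Sum.Properties using (inj₁-injective; inj₂-injective)
open import Data.Sum.Relation.Binary.Pointwise
  using (Pointwise; inj₁; inj₂; ⊎-decidable; ⊎-refl; ⊎-transitive)
open import Data.Unit using (⊤; tt)
open import Data.Vec.Functional using (_++_; _∷_; [])
open import Function using (_∘_; id; Injective; _↔_; mk↔ₛ′; Inverse)
open import Function.Properties.Inverse using (↔-refl; ↔-sym; ↔-trans)
open import Relation.Binary.PropositionalEquality
  using (_≡_; _≢_; refl; sym; trans; cong; cong₂; subst; subst₂; module ≡-Reasoning)
open import Relation.Nullary using (¬_; Dec; yes; no; contradiction)
open import Relation.Nullary.Decidable
  using (⌊_⌋; map′; _×-dec_; toWitness; fromWitness; dec-true; dec-false; isYes≗does)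

≢-uncong : ∀ {A B : Set} (f : A → B) {x y} → f x ≢ f y → x ≢ y
≢-uncong f fx≢fy = fx≢fy ∘ cong f

toℕ-≢ : ∀ {n} {s t : Fin n} → s ≢ t → toℕ s ≢ toℕ t
toℕ-≢ s≢t = s≢t ∘ toℕ-injective

bounded-injective⇒≤ : ∀ {k K} (σ : Fin k → ℕ) → (∀ i → σ i < K) →
                      Injective _≡_ _≡_ σ → k ≤ K
bounded-injective⇒≤ σ σ<K σ-injective = Fin.injective⇒≤ fin-injective
  where
  fin-injective : Injective _≡_ _≡_ (λ i → fromℕ< (σ<K i))
  fin-injective {i} {j} eq = σ-injective (begin
    σ i                  ≡⟨ toℕ-fromℕ< (σ<K i) ⟨
    toℕ (fromℕ< (σ<K i)) ≡⟨ cong toℕ eq ⟩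
    toℕ (fromℕ< (σ<K j)) ≡⟨ toℕ-fromℕ< (σ<K j) ⟩
    σ j                  ∎)
    where open ≡-Reasoning

injective-avoids : ∀ {a L} (h : Fin L → ℕ) → Injective _≡_ _≡_ h →
                   (F : Fin a → ℕ) → a < L → ∃ λ l → ∀ i → h l ≢ F i
injective-avoids {a} {L} h h-injective F a<L
  with all? (λ l → any? (λ i → h l ℕ.≟ F i))
... | yes hits = contradiction (Fin.injective⇒≤ hit-injective) (ℕ.<⇒≱ a<L)
  where
  hit-injective : Injective _≡_ _≡_ (λ l → proj₁ (hits l))
  hit-injective {l} {l′} eq =
    h-injective (trans (proj₂ (hits l)) (trans (cong F eq) (sym (proj₂ (hits l′)))))
... | no ¬hits with l , misses ← ¬∀⟶∃¬ L _ (λ l → any? (λ i → h l ℕ.≟ F i)) ¬hits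
  = l , λ i eq → misses (i , eq)

-- Decidable partial orders and colourings

-- Posets are built on structured carriers and only enumerated at the end (toFinPoset).
record DecOrder : Set₁ where
  infix 4 _≼_ _≼?_ _≟_ _∥_
  field
    Carrier   : Set
    _≼_       : Carrier → Carrier → Set
    _≼?_      : ∀ a b → Dec (a ≼ b)
    ≼-refl    : ∀ {a} → a ≼ a
    ≼-antisym : ∀ {a b} → a ≼ b → b ≼ a → a ≡ b
    ≼-trans   : ∀ {a b c} → a ≼ b → b ≼ c → a ≼ c

  _≟_ : ∀ a b → Dec (a ≡ b)
  a ≟ b = map′ (λ (a≼b , b≼a) → ≼-antisym a≼b b≼a) (λ { refl → ≼-refl , ≼-refl })
               ((a ≼? b) ×-dec (b ≼? a))

  _∥_ : Carrier → Carrier → Set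
  a ∥ b = ¬ a ≼ b × ¬ b ≼ a

module _ (P : DecOrder) where
  open DecOrder P

  record IsProperOn (S : Carrier → Set) (c : Carrier → ℕ) : Set where
    field
      separates : ∀ {a b} → S a → S b → a ≢ b → a ≼ b → c a ≢ c b

  IsProper : (Carrier → ℕ) → Set
  IsProper = IsProperOn (λ _ → ⊤)

  IsProperOff : Carrier → (Carrier → ℕ) → Set
  IsProperOff t = IsProperOn (_≢ t)

  record RainbowAntichain {I : Set} (c : Carrier → ℕ) (g : I → Carrier) : Set where
    field
      incomparable : ∀ {i j} → i ≢ j → ¬ g i ≼ g j
      colourful    : ∀ {i j} → i ≢ j → c (g i) ≢ c (g j)

  Forces : ℕ → Set
  Forces k = ∀ c → IsProper c → Σ (Fin k → Carrier) (RainbowAntichain c)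

  Robust : ℕ → ℕ → Set
  Robust m p = ∀ c → IsProper c → (F : Fin p → ℕ) →
               Σ (Fin m → Carrier) λ g → RainbowAntichain c g × (∀ i j → c (g i) ≢ F j)

  record Colourable (k : ℕ) : Set where
    field
      colour   : Carrier → ℕ
      colour-< : ∀ a → colour a < k
      proper   : IsProper colour

  record Spoiler (k : ℕ) (t : Carrier) : Set where
    field
      colour     : Carrier → ℕ
      proper     : IsProperOff t colour
      no-rainbow : (g : Fin k → Carrier) → (∀ i → g i ≢ t) → ¬ RainbowAntichain colour g

  Critical : ℕ → Set
  Critical k = ∀ t → Spoiler k t

  record Ranking (S : Carrier → Set) (c : Carrier → ℕ) (K : ℕ) : Set where
    field
      rank           : Carrier → ℕ
      rank-<         : ∀ {a} → S a → rank a < K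
      rank-injective : ∀ {a b} → S a → S b → a ∥ b → c a ≢ c b → rank a ≢ rank b

  record RankedSpoiler (m : ℕ) (t : Carrier) : Set where
    field
      colour   : Carrier → ℕ
      colour-≤ : ∀ {a} → a ≢ t → colour a ≤ m
      proper   : IsProperOff t colour
      ranking  : Ranking (_≢ t) colour m

open IsProperOn public
open RainbowAntichain public
open Ranking public

module _ {P : DecOrder} where
  open DecOrder P

  ∥-sym : ∀ {a b} → a ∥ b → b ∥ a
  ∥-sym (a⋠b , b⋠a) = b⋠a , a⋠b

  rainbow-∥ : ∀ {I : Set} {c} {g : I → Carrier} → RainbowAntichain P c g →
              ∀ {i j} → i ≢ j → g i ∥ g j
  rainbow-∥ rainbow i≢j = incomparable rainbow i≢j , incomparable rainbow (i≢j ∘ sym)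

  rainbow-∘ : ∀ {I J : Set} {c} {g : I → Carrier} {f : J → I} →
              RainbowAntichain P c g → Injective _≡_ _≡_ f → RainbowAntichain P c (g ∘ f)
  rainbow-∘ rainbow f-injective = record
    { incomparable = incomparable rainbow ∘ (_∘ f-injective)
    ; colourful    = colourful rainbow ∘ (_∘ f-injective)
    }

  rainbow-cong : ∀ {I : Set} {c} {g g′ : I → Carrier} → (∀ i → g i ≡ g′ i) →
                 RainbowAntichain P c g → RainbowAntichain P c g′
  rainbow-cong {c = c} g≗g′ rainbow = record
    { incomparable = λ {i} {j} → subst₂ (λ a b → ¬ a ≼ b) (g≗g′ i) (g≗g′ j) ∘ incomparable rainbow
    ; colourful    = λ {i} {j} → subst₂ (λ a b → c a ≢ c b) (g≗g′ i) (g≗g′ j) ∘ colourful rainbow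
    }

  monotone-comparable : ∀ {n} (f : Fin n → Carrier) → (∀ {i j} → i Fin.≤ j → f i ≼ f j) →
                        ∀ {i j} → ¬ f i ∥ f j
  monotone-comparable f mono {i} {j} (fi⋠fj , fj⋠fi) with Fin.≤-total i j
  ... | inj₁ i≤j = fi⋠fj (mono i≤j)
  ... | inj₂ j≤i = fj⋠fi (mono j≤i)

  proper-monotone-injective : ∀ {n c} → IsProper P c → (f : Fin n → Carrier) →
                              Injective _≡_ _≡_ f → (∀ {i j} → i Fin.≤ j → f i ≼ f j) →
                              Injective _≡_ _≡_ (c ∘ f)
  proper-monotone-injective proper f f-injective mono {i} {j} eq with i Fin.≟ j
  ... | yes i≡j = i≡j
  ... | no i≢j with Fin.≤-total i j
  ...   | inj₁ i≤j = contradiction eq (separates proper tt tt (i≢j ∘ f-injective) (mono i≤j))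
  ...   | inj₂ j≤i =
    contradiction (sym eq) (separates proper tt tt (i≢j ∘ sym ∘ f-injective) (mono j≤i))

  colour-ranking : ∀ {S c K} → (∀ {a} → S a → c a < K) → Ranking P S c K
  colour-ranking {c = c} c<K = record
    { rank = c ; rank-< = c<K ; rank-injective = λ _ _ _ ca≢cb → ca≢cb }

  ranking-bound : ∀ {S c K k} → Ranking P S c K → (g : Fin k → Carrier) → (∀ i → S (g i)) →
                  RainbowAntichain P c g → k ≤ K
  ranking-bound r g g∈S rainbow =
    bounded-injective⇒≤ (rank r ∘ g) (λ i → rank-< r (g∈S i)) rank-g-injective
    where
    rank-g-injective : Injective _≡_ _≡_ (rank r ∘ g)
    rank-g-injective {i} {j} eq with i Fin.≟ j
    ... | yes i≡j = i≡j
    ... | no i≢j  = contradiction eq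
      (rank-injective r (g∈S i) (g∈S j) (rainbow-∥ rainbow i≢j) (colourful rainbow i≢j))

  ranked-spoiler : ∀ {m t c} → IsProperOff P t c → Ranking P (_≢ t) c m → Spoiler P (suc m) t
  ranked-spoiler {c = c} proper ranking = record
    { colour = c
    ; proper = proper
    ; no-rainbow = λ g g≢t rainbow → ℕ.1+n≰n (ranking-bound ranking g g≢t rainbow)
    }

  rankedSpoiler⇒spoiler : ∀ {m t} → RankedSpoiler P m t → Spoiler P (suc m) t
  rankedSpoiler⇒spoiler s = ranked-spoiler proper ranking
    where open RankedSpoiler s

  -- A rainbow antichain either misses the hub, and then has too few colours, or contains it,
  -- and then its other elements are incomparable to the hub.
  hub-spoiler : ∀ {m t hub c} → IsProperOff P t c →
                Ranking P (λ a → a ≢ t × a ≢ hub) c (suc m) →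
                Ranking P (λ a → a ≢ t × a ∥ hub) c m →
                Spoiler P (suc (suc m)) t
  hub-spoiler {m} {t} {hub} {c} proper away near =
    record { colour = c ; proper = proper ; no-rainbow = no-rainbow }
    where
    no-rainbow : (g : Fin (suc (suc m)) → Carrier) → (∀ i → g i ≢ t) → ¬ RainbowAntichain P c g
    no-rainbow g g≢t rainbow with any? (λ i → g i ≟ hub)
    ... | no hub∉g = ℕ.1+n≰n (ranking-bound away g (λ i → g≢t i , λ eq → hub∉g (i , eq)) rainbow)
    ... | yes (i₀ , gi₀≡hub) = ℕ.1+n≰n (ranking-bound near (g ∘ punchIn i₀) near-hub
                                          (rainbow-∘ rainbow (punchIn-injective i₀ _ _)))
      where
      near-hub : ∀ j → g (punchIn i₀ j) ≢ t × g (punchIn i₀ j) ∥ hub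
      near-hub j = g≢t _ , subst (g (punchIn i₀ j) ∥_) gi₀≡hub (rainbow-∥ rainbow (punchInᵢ≢i i₀ j))

  rainbow-triple : ∀ {c a b d} → a ∥ b → a ∥ d → b ∥ d → c a ≢ c b → c a ≢ c d → c b ≢ c d →
                   RainbowAntichain P c (a ∷ b ∷ d ∷ [])
  rainbow-triple {c} a∥b a∥d b∥d ca≢cb ca≢cd cb≢cd = record
    { incomparable = proj₁ ∘ proj₁ ∘ pairwise
    ; colourful    = proj₂ ∘ pairwise
    }
    where
    Apart : Carrier → Carrier → Set
    Apart x y = x ∥ y × c x ≢ c y
    flip : ∀ {x y} → Apart x y → Apart y x
    flip (x∥y , cx≢cy) = ∥-sym x∥y , cx≢cy ∘ sym
    pairwise : ∀ {i j} → i ≢ j → Apart ((_ ∷ _ ∷ _ ∷ []) i) ((_ ∷ _ ∷ _ ∷ []) j)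
    pairwise {zero}           {zero}           0≢0 = contradiction refl 0≢0
    pairwise {zero}           {suc zero}       _   = a∥b , ca≢cb
    pairwise {zero}           {suc (suc zero)} _   = a∥d , ca≢cd
    pairwise {suc zero}       {zero}           _   = flip (a∥b , ca≢cb)
    pairwise {suc zero}       {suc zero}       1≢1 = contradiction refl 1≢1
    pairwise {suc zero}       {suc (suc zero)} _   = b∥d , cb≢cd
    pairwise {suc (suc zero)} {zero}           _   = flip (a∥d , ca≢cd)
    pairwise {suc (suc zero)} {suc zero}       _   = flip (b∥d , cb≢cd)
    pairwise {suc (suc zero)} {suc (suc zero)} 2≢2 = contradiction refl 2≢2

  colourable-mono : ∀ {k k′} → k ≤ k′ → Colourable P k → Colourable P k′
  colourable-mono k≤k′ h = record
    { colour = colour ; colour-< = λ a → ℕ.<-≤-trans (colour-< a) k≤k′ ; proper = proper }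
    where open Colourable h

  ⌊≼?⌋≡true : ∀ {a b} → a ≼ b → ⌊ a ≼? b ⌋ ≡ true
  ⌊≼?⌋≡true {a} {b} a≼b = trans (isYes≗does (a ≼? b)) (dec-true (a ≼? b) a≼b)

  ⌊≼?⌋≡false : ∀ {a b} → ¬ a ≼ b → ⌊ a ≼? b ⌋ ≡ false
  ⌊≼?⌋≡false {a} {b} a⋠b = trans (isYes≗does (a ≼? b)) (dec-false (a ≼? b) a⋠b)

  ∥⇒≢ : ∀ {a b} → a ∥ b → a ≢ b
  ∥⇒≢ (a⋠b , _) refl = a⋠b ≼-refl

  proper-∘ : ∀ {S c} {f : ℕ → ℕ} → Injective _≡_ _≡_ f → IsProperOn P S c → IsProperOn P S (f ∘ c)
  proper-∘ f-injective proper .separates sa sb a≢b a≼b =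
    separates proper sa sb a≢b a≼b ∘ f-injective

  ranking-mono : ∀ {S S′ c K} → (∀ {a} → S′ a → S a) → Ranking P S c K → Ranking P S′ c K
  ranking-mono S′⊆S r = record
    { rank           = rank r
    ; rank-<         = rank-< r ∘ S′⊆S
    ; rank-injective = λ sa sb → rank-injective r (S′⊆S sa) (S′⊆S sb)
    }

-- Chains and disjoint sums

chain : ℕ → DecOrder
chain n = record
  { Carrier   = Fin n
  ; _≼_       = Fin._≤_
  ; _≼?_      = Fin._≤?_
  ; ≼-refl    = Fin.≤-refl
  ; ≼-antisym = Fin.≤-antisym
  ; ≼-trans   = Fin.≤-trans
  }

infixr 5 _⊕_
_⊕_ : DecOrder → DecOrder → DecOrder
P ⊕ Q = record
  { Carrier   = P.Carrier ⊎ Q.Carrier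
  ; _≼_       = Pointwise P._≼_ Q._≼_
  ; _≼?_      = ⊎-decidable P._≼?_ Q._≼?_
  ; ≼-refl    = ⊎-refl P.≼-refl Q.≼-refl
  ; ≼-antisym = ⊎-antisym
  ; ≼-trans   = ⊎-transitive P.≼-trans Q.≼-trans
  }
  where
  module P = DecOrder P
  module Q = DecOrder Q
  ⊎-antisym : ∀ {a b} → Pointwise P._≼_ Q._≼_ a b → Pointwise P._≼_ Q._≼_ b a → a ≡ b
  ⊎-antisym (inj₁ x≼y) (inj₁ y≼x) = cong inj₁ (P.≼-antisym x≼y y≼x)
  ⊎-antisym (inj₂ x≼y) (inj₂ y≼x) = cong inj₂ (Q.≼-antisym x≼y y≼x)

module _ {P Q : DecOrder} where
  open DecOrder using (Carrier)

  ⊕-properOn : ∀ {S c₁ c₂} → IsProperOn P (S ∘ inj₁) c₁ → IsProperOn Q (S ∘ inj₂) c₂ →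
               IsProperOn (P ⊕ Q) S [ c₁ , c₂ ]
  ⊕-properOn proper₁ proper₂ .separates {inj₁ _} {inj₁ _} s s′ x≢y (inj₁ x≼y) =
    separates proper₁ s s′ (x≢y ∘ cong inj₁) x≼y
  ⊕-properOn proper₁ proper₂ .separates {inj₂ _} {inj₂ _} s s′ x≢y (inj₂ x≼y) =
    separates proper₂ s s′ (x≢y ∘ cong inj₂) x≼y

  ⊕-proper : ∀ {c₁ c₂} → IsProper P c₁ → IsProper Q c₂ → IsProper (P ⊕ Q) [ c₁ , c₂ ]
  ⊕-proper = ⊕-properOn

  ⊕-properOff-inj₁ : ∀ {t c₁ c₂} → IsProperOff P t c₁ → IsProper Q c₂ →
                 IsProperOff (P ⊕ Q) (inj₁ t) [ c₁ , c₂ ]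
  ⊕-properOff-inj₁ proper₁ proper₂ = ⊕-properOn
    (record { separates = λ s s′ → separates proper₁ (s ∘ cong inj₁) (s′ ∘ cong inj₁) })
    (record { separates = λ _ _ → separates proper₂ tt tt })

  ⊕-properOff-inj₂ : ∀ {t c₁ c₂} → IsProper P c₁ → IsProperOff Q t c₂ →
                 IsProperOff (P ⊕ Q) (inj₂ t) [ c₁ , c₂ ]
  ⊕-properOff-inj₂ proper₁ proper₂ = ⊕-properOn
    (record { separates = λ _ _ → separates proper₁ tt tt })
    (record { separates = λ s s′ → separates proper₂ (s ∘ cong inj₂) (s′ ∘ cong inj₂) })

  proper-inj₁ : ∀ {c} → IsProper (P ⊕ Q) c → IsProper P (c ∘ inj₁)
  proper-inj₁ proper .separates _ _ x≢y x≼y =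
    separates proper tt tt (x≢y ∘ inj₁-injective) (inj₁ x≼y)

  proper-inj₂ : ∀ {c} → IsProper (P ⊕ Q) c → IsProper Q (c ∘ inj₂)
  proper-inj₂ proper .separates _ _ x≢y x≼y =
    separates proper tt tt (x≢y ∘ inj₂-injective) (inj₂ x≼y)

  ⊕-colourable : ∀ {k} → Colourable P k → Colourable Q k → Colourable (P ⊕ Q) k
  ⊕-colourable h₁ h₂ = record
    { colour   = [ colour h₁ , colour h₂ ]
    ; colour-< = [ colour-< h₁ , colour-< h₂ ]
    ; proper   = ⊕-proper (proper h₁) (proper h₂)
    }
    where open Colourable

  ⊕-rainbow : ∀ {I J : Set} {c} {g₁ : I → Carrier P} {g₂ : J → Carrier Q} →
              RainbowAntichain P (c ∘ inj₁) g₁ → RainbowAntichain Q (c ∘ inj₂) g₂ →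
              (∀ i j → c (inj₁ (g₁ i)) ≢ c (inj₂ (g₂ j))) →
              RainbowAntichain (P ⊕ Q) c [ inj₁ ∘ g₁ , inj₂ ∘ g₂ ]
  ⊕-rainbow r₁ _ _ .incomparable {inj₁ _} {inj₁ _} i≢j (inj₁ x≼y) =
    incomparable r₁ (i≢j ∘ cong inj₁) x≼y
  ⊕-rainbow _ r₂ _ .incomparable {inj₂ _} {inj₂ _} i≢j (inj₂ x≼y) =
    incomparable r₂ (i≢j ∘ cong inj₂) x≼y
  ⊕-rainbow r₁ _  _     .colourful {inj₁ _} {inj₁ _} i≢j = colourful r₁ (i≢j ∘ cong inj₁)
  ⊕-rainbow _  _  apart .colourful {inj₁ i} {inj₂ j} _   = apart i j
  ⊕-rainbow _  _  apart .colourful {inj₂ i} {inj₁ j} _   = apart j i ∘ sym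
  ⊕-rainbow _  r₂ _     .colourful {inj₂ _} {inj₂ _} i≢j = colourful r₂ (i≢j ∘ cong inj₂)

  rainbow-inj₂ : ∀ {I : Set} {c} {h : I → Carrier Q} →
                 RainbowAntichain (P ⊕ Q) c (inj₂ ∘ h) → RainbowAntichain Q (c ∘ inj₂) h
  rainbow-inj₂ rainbow = record
    { incomparable = λ i≢j x≼y → incomparable rainbow i≢j (inj₂ x≼y)
    ; colourful    = colourful rainbow
    }

  ∥-inj₁ : ∀ {x y} → DecOrder._∥_ (P ⊕ Q) (inj₁ x) (inj₁ y) → DecOrder._∥_ P x y
  ∥-inj₁ (x⋠y , y⋠x) = x⋠y ∘ inj₁ , y⋠x ∘ inj₁

  ⊕-ranking : ∀ {S₁ S₂ c₁ c₂ K₁ K₂} → Ranking P S₁ c₁ K₁ → Ranking Q S₂ c₂ K₂ →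
              Ranking (P ⊕ Q) [ S₁ , S₂ ] [ c₁ , c₂ ] (K₁ + K₂)
  ⊕-ranking {K₁ = K₁} r₁ r₂ .rank = [ rank r₁ , (K₁ +_) ∘ rank r₂ ]
  ⊕-ranking {K₁ = K₁} {K₂} r₁ r₂ .rank-< {inj₁ _} s = ℕ.<-≤-trans (rank-< r₁ s) (ℕ.m≤m+n K₁ K₂)
  ⊕-ranking {K₁ = K₁} r₁ r₂ .rank-< {inj₂ _} s = ℕ.+-monoʳ-< K₁ (rank-< r₂ s)
  ⊕-ranking r₁ r₂ .rank-injective {inj₁ _} {inj₁ _} s s′ (x⋠y , y⋠x) =
    rank-injective r₁ s s′ (x⋠y ∘ inj₁ , y⋠x ∘ inj₁)
  ⊕-ranking {K₁ = K₁} r₁ r₂ .rank-injective {inj₁ _} {inj₂ y} s _ _ _ =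
    ℕ.<⇒≢ (ℕ.<-≤-trans (rank-< r₁ s) (ℕ.m≤m+n K₁ (rank r₂ y)))
  ⊕-ranking {K₁ = K₁} r₁ r₂ .rank-injective {inj₂ x} {inj₁ _} _ s′ _ _ =
    ℕ.<⇒≢ (ℕ.<-≤-trans (rank-< r₁ s′) (ℕ.m≤m+n K₁ (rank r₂ x))) ∘ sym
  ⊕-ranking {K₁ = K₁} r₁ r₂ .rank-injective {inj₂ _} {inj₂ _} s s′ (x⋠y , y⋠x) cx≢cy =
    rank-injective r₂ s s′ (x⋠y ∘ inj₂ , y⋠x ∘ inj₂) cx≢cy ∘ ℕ.+-cancelˡ-≡ K₁ _ _

  ⊕-forces : ∀ {m p} → Robust P m p → Forces Q p → Forces (P ⊕ Q) (m + p)
  ⊕-forces {m} robust forces c proper with forces (c ∘ inj₂) (proper-inj₂ proper)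
  ... | g₂ , rainbow₂ with robust (c ∘ inj₁) (proper-inj₁ proper) (c ∘ inj₂ ∘ g₂)
  ...   | g₁ , rainbow₁ , apart =
    (inj₁ ∘ g₁) ++ (inj₂ ∘ g₂) , rainbow-∘ (⊕-rainbow rainbow₁ rainbow₂ apart) splitAt-injective
    where
    splitAt-injective : Injective _≡_ _≡_ (splitAt m)
    splitAt-injective {i} {j} eq =
      trans (sym (join-splitAt m _ i)) (trans (cong (Fin.join m _) eq) (join-splitAt m _ j))

toℕ-proper : ∀ {n} → IsProper (chain n) toℕ
toℕ-proper .separates _ _ i≢j _ = i≢j ∘ toℕ-injective

chain-colourable : ∀ {n} → Colourable (chain n) n
chain-colourable = record { colour = toℕ ; colour-< = toℕ<n ; proper = toℕ-proper }

chain-robust : ∀ {k} → Robust (chain (suc k)) 1 k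
chain-robust {k} c proper F =
  (λ _ → proj₁ avoider) , record { incomparable = absurd ; colourful = absurd } , λ _ → proj₂ avoider
  where
  avoider : ∃ λ l → ∀ j → c l ≢ F j
  avoider = injective-avoids c (proper-monotone-injective {P = chain (suc k)} proper id id id)
                             F (ℕ.n<1+n k)
  absurd : ∀ {A : Set} {i j : Fin 1} → i ≢ j → A
  absurd {i = zero} {zero} 0≢0 = contradiction refl 0≢0

chain-ranking : ∀ {n S c} → Ranking (chain n) S c 1
chain-ranking = record
  { rank = λ _ → 0
  ; rank-< = λ _ → s≤s z≤n
  ; rank-injective = λ _ _ i∥j _ _ → monotone-comparable {P = chain _} id id i∥j
  }

-- The value at j = i is junk.
skip : ∀ {n} → Fin (suc n) → Fin (suc n) → ℕ
skip i j with i Fin.≟ j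
... | yes _   = 0
... | no i≢j = toℕ (punchOut i≢j)

module _ {n : ℕ} {i : Fin (suc n)} where

  skip-< : ∀ {j} → j ≢ i → skip i j < n
  skip-< {j} j≢i with i Fin.≟ j
  ... | yes i≡j = contradiction (sym i≡j) j≢i
  ... | no _    = toℕ<n _

  skip-injective : ∀ {j k} → j ≢ i → k ≢ i → skip i j ≡ skip i k → j ≡ k
  skip-injective {j} {k} j≢i k≢i eq with i Fin.≟ j | i Fin.≟ k
  ... | yes i≡j | _       = contradiction (sym i≡j) j≢i
  ... | no _    | yes i≡k = contradiction (sym i≡k) k≢i
  ... | no i≢j  | no i≢k  = punchOut-injective i≢j i≢k (toℕ-injective eq)

  skip-properOff : IsProperOff (chain (suc n)) i (skip i)
  skip-properOff .separates j≢i k≢i j≢k _ = j≢k ∘ skip-injective j≢i k≢i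

skip-zero : ∀ {n} {i : Fin (suc (suc n))} → zero ≢ i → skip i zero ≡ 0
skip-zero {i = zero}  0≢0 = contradiction refl 0≢0
skip-zero {i = suc _} _   = refl

toℕ-punchOut-last : ∀ {n} {i : Fin (suc (suc n))} (i≢last : i ≢ fromℕ (suc n)) →
                    toℕ (punchOut i≢last) ≡ n
toℕ-punchOut-last {n}     {zero}     _      = toℕ-fromℕ n
toℕ-punchOut-last {zero}  {suc zero} i≢last = contradiction refl i≢last
toℕ-punchOut-last {suc _} {suc _}    i≢last = cong suc (toℕ-punchOut-last (i≢last ∘ cong suc))

skip-last : ∀ {n} {i : Fin (suc (suc n))} → fromℕ (suc n) ≢ i → skip i (fromℕ (suc n)) ≡ n
skip-last {n} {i} last≢i with i Fin.≟ fromℕ (suc n)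
... | yes i≡last = contradiction (sym i≡last) last≢i
... | no i≢last  = toℕ-punchOut-last i≢last

-- Adjoining a chain

module _ {A B : Set} where

  inj₁? : (x : A ⊎ B) → Dec (∃ λ a → x ≡ inj₁ a)
  inj₁? (inj₁ a) = yes (a , refl)
  inj₁? (inj₂ _) = no λ ()

  all-inj₂ : ∀ {k} (f : Fin k → A ⊎ B) → (∀ j a → f j ≢ inj₁ a) →
             Σ (Fin k → B) λ h → ∀ j → f j ≡ inj₂ (h j)
  all-inj₂ f f≢inj₁ = proj₁ ∘ rightᶠ , proj₂ ∘ rightᶠ
    where
    right : (x : A ⊎ B) → (∀ a → x ≢ inj₁ a) → ∃ λ b → x ≡ inj₂ b
    right (inj₁ a) x≢inj₁ = contradiction refl (x≢inj₁ a)
    right (inj₂ b) _      = b , refl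
    rightᶠ : ∀ j → ∃ λ b → f j ≡ inj₂ b
    rightᶠ j = right (f j) (f≢inj₁ j)

  all-inj₂-but-one : ∀ {k} (g : Fin (suc k) → A ⊎ B) →
                     (∀ {i j a b} → i ≢ j → g i ≡ inj₁ a → g j ≡ inj₁ b → ⊥) →
                     Σ (Fin (suc k)) λ i₀ → Σ (Fin k → B) λ h → ∀ j → g (punchIn i₀ j) ≡ inj₂ (h j)
  all-inj₂-but-one g unique with any? (λ i → inj₁? (g i))
  ... | yes (i₀ , _ , gi₀≡inj₁) =
    i₀ , all-inj₂ (g ∘ punchIn i₀) (λ j _ eq → unique (punchInᵢ≢i i₀ j) eq gi₀≡inj₁)
  ... | no none = zero , all-inj₂ (g ∘ suc) (λ j a eq → none (suc j , a , eq))

module _ {P : DecOrder} {k : ℕ} where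
  open DecOrder (chain (suc k) ⊕ P) using (Carrier; _∥_)

  chain⊕-forces : Forces P k → Forces (chain (suc k) ⊕ P) (suc k)
  chain⊕-forces = ⊕-forces chain-robust

  chain⊕-colourable : Colourable P k → Colourable (chain (suc k) ⊕ P) (suc k)
  chain⊕-colourable = ⊕-colourable chain-colourable ∘ colourable-mono (ℕ.n≤1+n k)

  chain⊕-rankedSpoiler-inj₁ : Colourable P k → ∀ l → RankedSpoiler (chain (suc k) ⊕ P) k (inj₁ l)
  chain⊕-rankedSpoiler-inj₁ record { colour = h ; colour-< = h<k ; proper = h-proper } l = record
    { colour   = [ skip l , h ]
    ; colour-≤ = ℕ.<⇒≤ ∘ colour-<
    ; proper   = ⊕-properOff-inj₁ skip-properOff h-proper
    ; ranking  = colour-ranking colour-<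
    }
    where
    colour-< : ∀ {a} → a ≢ inj₁ l → [ skip l , h ] a < k
    colour-< {inj₁ j} j≢l = skip-< (≢-uncong inj₁ j≢l)
    colour-< {inj₂ x} _   = h<k x

  chain⊕-spoiler-inj₂ : ∀ {t} → Spoiler P k t → Spoiler (chain (suc k) ⊕ P) (suc k) (inj₂ t)
  chain⊕-spoiler-inj₂ {t} s = record
    { colour     = [ toℕ , colour ]
    ; proper     = ⊕-properOff-inj₂ toℕ-proper proper
    ; no-rainbow = no-rainbow′
    }
    where
    open Spoiler s
    no-rainbow′ : (g : Fin (suc k) → Carrier) → (∀ i → g i ≢ inj₂ t) →
                  ¬ RainbowAntichain _ [ toℕ , colour ] g
    no-rainbow′ g g≢t rainbow with all-inj₂-but-one g chain-unique
      where
      chain-unique : ∀ {i j a b} → i ≢ j → g i ≡ inj₁ a → g j ≡ inj₁ b → ⊥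
      chain-unique i≢j gi≡a gj≡b =
        monotone-comparable {P = chain (suc k) ⊕ P} inj₁ inj₁
          (subst₂ _∥_ gi≡a gj≡b (rainbow-∥ rainbow i≢j))
    ... | i₀ , h , g≗h =
      no-rainbow h (λ j h≡t → g≢t (punchIn i₀ j) (trans (g≗h j) (cong inj₂ h≡t)))
        (rainbow-inj₂ (rainbow-cong g≗h (rainbow-∘ rainbow (punchIn-injective i₀ _ _))))

  chain⊕-critical : Colourable P k → Critical P k → Critical (chain (suc k) ⊕ P) (suc k)
  chain⊕-critical colourable _ (inj₁ l) =
    rankedSpoiler⇒spoiler (chain⊕-rankedSpoiler-inj₁ colourable l)
  chain⊕-critical _ critical (inj₂ t) = chain⊕-spoiler-inj₂ (critical t)

chain⊕-rankedSpoiler-inj₂ : ∀ {P m t} → RankedSpoiler P m t →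
                        RankedSpoiler (chain (suc (suc m)) ⊕ P) (suc m) (inj₂ t)
chain⊕-rankedSpoiler-inj₂ {P} {m} {t} s = record
  { colour   = [ toℕ , colour ]
  ; colour-≤ = colour-≤′
  ; proper   = ⊕-properOff-inj₂ toℕ-proper proper
  ; ranking  = ranking-mono {P = chain _ ⊕ P} rest (⊕-ranking chain-ranking ranking)
  }
  where
  open RankedSpoiler s
  colour-≤′ : ∀ {a} → a ≢ inj₂ t → [ toℕ , colour ] a ≤ suc m
  colour-≤′ {inj₁ j} _   = ℕ.≤-pred (toℕ<n j)
  colour-≤′ {inj₂ _} x≢t = ℕ.m≤n⇒m≤1+n (colour-≤ (≢-uncong inj₂ x≢t))
  rest : ∀ {a} → a ≢ inj₂ t → [ (λ _ → ⊤) , _≢ t ] a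
  rest {inj₁ _} _   = tt
  rest {inj₂ _} a≢t = a≢t ∘ cong inj₂

chains : ℕ → DecOrder
chains zero    = chain 0
chains (suc n) = chain (suc n) ⊕ chains n

chains-forces : ∀ n → Forces (chains n) n
chains-forces zero    _ _ = (λ ()) , record { incomparable = λ { {()} } ; colourful = λ { {()} } }
chains-forces (suc n) = chain⊕-forces (chains-forces n)

chains-colourable : ∀ n → Colourable (chains n) n
chains-colourable zero    = chain-colourable
chains-colourable (suc n) = chain⊕-colourable (chains-colourable n)

chains-rankedSpoiler : ∀ m t → RankedSpoiler (chains (suc m)) m t
chains-rankedSpoiler m       (inj₁ l) = chain⊕-rankedSpoiler-inj₁ (chains-colourable m) l
chains-rankedSpoiler (suc m) (inj₂ t) = chain⊕-rankedSpoiler-inj₂ (chains-rankedSpoiler m t)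

-- The core

data Core (p : ℕ) : Set where
  E D : Fin (suc p) → Core p
  Y   : Fin (2 + p) → Core p
  X   : Fin (3 + p) → Core p

module _ {p : ℕ} where

  top : Fin (3 + p)
  top = fromℕ (2 + p)

  infix 4 _≤ᶜ_ _≤ᶜ?_
  data _≤ᶜ_ : Core p → Core p → Set where
    E≤E  : ∀ {s t} → s Fin.≤ t → E s ≤ᶜ E t
    D≤D  : ∀ {s t} → s Fin.≤ t → D s ≤ᶜ D t
    Y≤Y  : ∀ {s t} → s Fin.≤ t → Y s ≤ᶜ Y t
    X≤X  : ∀ {s t} → s Fin.≤ t → X s ≤ᶜ X t
    X₀≤D : ∀ {t} → X zero ≤ᶜ D t
    E≤X⊤ : ∀ {s} → E s ≤ᶜ X top

  _≤ᶜ?_ : ∀ a b → Dec (a ≤ᶜ b)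
  E s ≤ᶜ? E t = map′ E≤E (λ { (E≤E s≤t) → s≤t }) (s Fin.≤? t)
  D s ≤ᶜ? D t = map′ D≤D (λ { (D≤D s≤t) → s≤t }) (s Fin.≤? t)
  Y s ≤ᶜ? Y t = map′ Y≤Y (λ { (Y≤Y s≤t) → s≤t }) (s Fin.≤? t)
  X s ≤ᶜ? X t = map′ X≤X (λ { (X≤X s≤t) → s≤t }) (s Fin.≤? t)
  X s ≤ᶜ? D _ = map′ (λ { refl → X₀≤D }) (λ { X₀≤D → refl }) (s Fin.≟ zero)
  E _ ≤ᶜ? X t = map′ (λ { refl → E≤X⊤ }) (λ { E≤X⊤ → refl }) (t Fin.≟ top)
  E _ ≤ᶜ? D _ = no λ ()
  E _ ≤ᶜ? Y _ = no λ ()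
  D _ ≤ᶜ? E _ = no λ ()
  D _ ≤ᶜ? Y _ = no λ ()
  D _ ≤ᶜ? X _ = no λ ()
  Y _ ≤ᶜ? E _ = no λ ()
  Y _ ≤ᶜ? D _ = no λ ()
  Y _ ≤ᶜ? X _ = no λ ()
  X _ ≤ᶜ? E _ = no λ ()
  X _ ≤ᶜ? Y _ = no λ ()

  ≤ᶜ-refl : ∀ {a} → a ≤ᶜ a
  ≤ᶜ-refl {E _} = E≤E Fin.≤-refl
  ≤ᶜ-refl {D _} = D≤D Fin.≤-refl
  ≤ᶜ-refl {Y _} = Y≤Y Fin.≤-refl
  ≤ᶜ-refl {X _} = X≤X Fin.≤-refl

  ≤ᶜ-antisym : ∀ {a b} → a ≤ᶜ b → b ≤ᶜ a → a ≡ b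
  ≤ᶜ-antisym (E≤E s≤t) (E≤E t≤s) = cong E (Fin.≤-antisym s≤t t≤s)
  ≤ᶜ-antisym (D≤D s≤t) (D≤D t≤s) = cong D (Fin.≤-antisym s≤t t≤s)
  ≤ᶜ-antisym (Y≤Y s≤t) (Y≤Y t≤s) = cong Y (Fin.≤-antisym s≤t t≤s)
  ≤ᶜ-antisym (X≤X s≤t) (X≤X t≤s) = cong X (Fin.≤-antisym s≤t t≤s)

  ≤ᶜ-trans : ∀ {a b c} → a ≤ᶜ b → b ≤ᶜ c → a ≤ᶜ c
  ≤ᶜ-trans (E≤E r) (E≤E s)             = E≤E (Fin.≤-trans r s)
  ≤ᶜ-trans (E≤E _) E≤X⊤                = E≤X⊤
  ≤ᶜ-trans (D≤D r) (D≤D s)             = D≤D (Fin.≤-trans r s)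
  ≤ᶜ-trans (Y≤Y r) (Y≤Y s)             = Y≤Y (Fin.≤-trans r s)
  ≤ᶜ-trans (X≤X r) (X≤X s)             = X≤X (Fin.≤-trans r s)
  ≤ᶜ-trans (X≤X {zero} _) X₀≤D         = X₀≤D
  ≤ᶜ-trans X₀≤D (D≤D _)                = X₀≤D
  ≤ᶜ-trans E≤X⊤ (X≤X {t = t} top≤t)
    rewrite Fin.≤-antisym (Fin.≤fromℕ t) top≤t = E≤X⊤

core : ℕ → DecOrder
core p = record
  { Carrier   = Core p
  ; _≼_       = _≤ᶜ_
  ; _≼?_      = _≤ᶜ?_
  ; ≼-refl    = ≤ᶜ-refl
  ; ≼-antisym = ≤ᶜ-antisym
  ; ≼-trans   = ≤ᶜ-trans
  }


module _ {p : ℕ} where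

  toℕ-top : toℕ (top {p}) ≡ 2 + p
  toℕ-top = toℕ-fromℕ (2 + p)

  paint : (Fin (suc p) → ℕ) → (Fin (suc p) → ℕ) → (Fin (2 + p) → ℕ) → (Fin (3 + p) → ℕ) →
          Core p → ℕ
  paint fE _  _  _  (E s) = fE s
  paint _  fD _  _  (D s) = fD s
  paint _  _  fY _  (Y s) = fY s
  paint _  _  _  fX (X s) = fX s

  paint-properOn : ∀ {S fE fD fY fX} →
                   (∀ {s t} → S (E s) → S (E t) → s ≢ t → fE s ≢ fE t) →
                   (∀ {s t} → S (D s) → S (D t) → s ≢ t → fD s ≢ fD t) →
                   (∀ {s t} → S (Y s) → S (Y t) → s ≢ t → fY s ≢ fY t) →
                   (∀ {s t} → S (X s) → S (X t) → s ≢ t → fX s ≢ fX t) →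
                   (∀ {t} → S (X zero) → S (D t) → fX zero ≢ fD t) →
                   (∀ {s} → S (E s) → S (X top) → fE s ≢ fX top) →
                   IsProperOn (core p) S (paint fE fD fY fX)
  paint-properOn e _ _ _ _  _  .separates sa sb a≢b (E≤E _) = e sa sb (a≢b ∘ cong E)
  paint-properOn _ d _ _ _  _  .separates sa sb a≢b (D≤D _) = d sa sb (a≢b ∘ cong D)
  paint-properOn _ _ y _ _  _  .separates sa sb a≢b (Y≤Y _) = y sa sb (a≢b ∘ cong Y)
  paint-properOn _ _ _ x _  _  .separates sa sb a≢b (X≤X _) = x sa sb (a≢b ∘ cong X)
  paint-properOn _ _ _ _ xd _  .separates sa sb _   X₀≤D    = xd sa sb
  paint-properOn _ _ _ _ _  ex .separates sa sb _   E≤X⊤    = ex sa sb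

  E≢top : ∀ {s : Fin (suc p)} → toℕ s ≢ toℕ (top {p})
  E≢top {s} = ℕ.<⇒≢ (subst (toℕ s <_) (sym toℕ-top) (ℕ.m≤n⇒m≤o+n 1 (toℕ<n s)))

  height : Core p → ℕ
  height = paint toℕ (suc ∘ toℕ) toℕ toℕ

  height-proper : IsProper (core p) height
  height-proper = paint-properOn (λ _ _ → toℕ-≢) (λ _ _ s≢t → toℕ-≢ s≢t ∘ ℕ.suc-injective)
                    (λ _ _ → toℕ-≢) (λ _ _ → toℕ-≢) (λ _ _ ()) (λ _ _ → E≢top)

  core-colourable : Colourable (core p) (3 + p)
  core-colourable = record { colour = height ; colour-< = height-< ; proper = height-proper }
    where
    height-< : ∀ a → height a < 3 + p
    height-< (E s) = ℕ.m≤n⇒m≤o+n 2 (toℕ<n s)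
    height-< (D s) = s≤s (ℕ.m≤n⇒m≤o+n 1 (toℕ<n s))
    height-< (Y s) = ℕ.m≤n⇒m≤o+n 1 (toℕ<n s)
    height-< (X s) = toℕ<n s

module CoreTriple {p : ℕ} (c : Core p → ℕ) (proper : IsProper (core p) c) (F : Fin p → ℕ) where
  open DecOrder (core p) using (_∥_)

  Avoids : Core p → Set
  Avoids a = ∀ j → c a ≢ F j

  Triple : Set
  Triple = Σ (Fin 3 → Core p) λ g → RainbowAntichain (core p) c g × (∀ i → Avoids (g i))

  triple : ∀ {a b d} → a ∥ b → a ∥ d → b ∥ d → c a ≢ c b → c a ≢ c d → c b ≢ c d →
           Avoids a → Avoids b → Avoids d → Triple
  triple a∥b a∥d b∥d ca≢cb ca≢cd cb≢cd a∉F b∉F d∉F =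
    _ , rainbow-triple a∥b a∥d b∥d ca≢cb ca≢cd cb≢cd , λ where
      zero             → a∉F
      (suc zero)       → b∉F
      (suc (suc zero)) → d∉F

  colour-injective : ∀ {n} (f : Fin n → Core p) → Injective _≡_ _≡_ f →
                     (∀ {s t} → s Fin.≤ t → f s ≤ᶜ f t) → Injective _≡_ _≡_ (c ∘ f)
  colour-injective = proper-monotone-injective {P = core p} proper

  avoiding : ∀ {n a} (f : Fin n → Core p) → Injective _≡_ _≡_ f →
             (∀ {s t} → s Fin.≤ t → f s ≤ᶜ f t) → (G : Fin a → ℕ) → a < n →
             ∃ λ s → ∀ j → c (f s) ≢ G j
  avoiding f f-injective mono = injective-avoids (c ∘ f) (colour-injective f f-injective mono)

  d-choice = avoiding D (λ { refl → refl }) D≤D F (ℕ.n<1+n p)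
  e-choice = avoiding E (λ { refl → refl }) E≤E F (ℕ.n<1+n p)
  y₁-choice = avoiding Y (λ { refl → refl }) Y≤Y F (ℕ.m≤n⇒m≤o+n 1 (ℕ.n<1+n p))
  y₂-choice = avoiding Y (λ { refl → refl }) Y≤Y (c (Y (proj₁ y₁-choice)) ∷ F) (ℕ.n<1+n (suc p))

  td = proj₁ d-choice
  te = proj₁ e-choice
  cd = c (D td)
  ce = c (E te)

  pickY : ∀ v → Σ (Fin (2 + p)) λ y → c (Y y) ≢ v × Avoids (Y y)
  pickY v with c (Y (proj₁ y₁-choice)) ℕ.≟ v
  ... | no y₁≢v  = proj₁ y₁-choice , y₁≢v , proj₂ y₁-choice
  ... | yes y₁≡v = proj₁ y₂-choice , (λ y₂≡v → proj₂ y₂-choice zero (trans y₂≡v (sym y₁≡v))) ,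
                   λ j → proj₂ y₂-choice (suc j)

  D-E-Y : ∀ {y} → cd ≢ ce → c (Y y) ≢ cd → c (Y y) ≢ ce → Avoids (Y y) → Triple
  D-E-Y cd≢ce y≢cd y≢ce y∉F = triple ((λ ()) , (λ ())) ((λ ()) , (λ ())) ((λ ()) , (λ ()))
    cd≢ce (y≢cd ∘ sym) (y≢ce ∘ sym) (proj₂ d-choice) (proj₂ e-choice) y∉F

  ∉-pair : ∀ {u v w x : ℕ} → u ≡ v ⊎ u ≡ w → x ≢ v → x ≢ w → u ≢ x
  ∉-pair (inj₁ refl) x≢v _ = x≢v ∘ sym
  ∉-pair (inj₂ refl) _ x≢w = x≢w ∘ sym

  -- An X-element of a fresh colour replaces D or E: X zero is incomparable to all of E and
  -- every other X-element to all of D.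
  via-X : ∀ {yb ye} → c (Y yb) ≢ cd → Avoids (Y yb) →
          c (Y ye) ≡ cd ⊎ c (Y ye) ≡ c (Y yb) → c (Y ye) ≢ ce → Avoids (Y ye) →
          ce ≡ cd ⊎ ce ≡ c (Y yb) → Triple
  via-X {yb} {ye} yb≢cd yb∉F ye∈ ye≢ce ye∉F ce∈
    with avoiding X (λ { refl → refl }) X≤X (cd ∷ c (Y yb) ∷ F) (ℕ.n<1+n (2 + p))
  ... | zero , x∉ = triple ((λ ()) , (λ ())) ((λ ()) , (λ ())) ((λ ()) , (λ ()))
    (∉-pair ce∈ (x∉ zero) (x∉ (suc zero))) (ye≢ce ∘ sym)
    (∉-pair ye∈ (x∉ zero) (x∉ (suc zero)) ∘ sym)
    (proj₂ e-choice) (λ j → x∉ (suc (suc j))) ye∉F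
  ... | suc tx , x∉ = triple ((λ ()) , (λ ())) ((λ ()) , (λ ())) ((λ ()) , (λ ()))
    (x∉ zero ∘ sym) (yb≢cd ∘ sym) (x∉ (suc zero))
    (proj₂ d-choice) (λ j → x∉ (suc (suc j))) yb∉F

  triple-avoiding : Triple
  triple-avoiding with pickY ce
  ... | y , y≢ce , y∉F with c (Y y) ℕ.≟ cd
  ...   | no y≢cd with cd ℕ.≟ ce
  ...     | yes cd≡ce = via-X y≢cd y∉F (inj₂ refl) y≢ce y∉F (inj₁ (sym cd≡ce))
  ...     | no cd≢ce  = D-E-Y cd≢ce y≢cd y≢ce y∉F
  triple-avoiding | y , y≢ce , y∉F | yes y≡cd with pickY cd
  ... | y′ , y′≢cd , y′∉F with c (Y y′) ℕ.≟ ce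
  ...   | yes y′≡ce = via-X y′≢cd y′∉F (inj₁ y≡cd) y≢ce y∉F (inj₂ (sym y′≡ce))
  ...   | no y′≢ce  = D-E-Y (λ cd≡ce → y≢ce (trans y≡cd cd≡ce)) y′≢cd y′≢ce y′∉F

core-robust : ∀ {p} → Robust (core p) 3 p
core-robust c proper F = CoreTriple.triple-avoiding c proper F

rotate : ∀ {n} → Fin (suc n) → ℕ
rotate {n} zero    = n
rotate     (suc s) = toℕ s

rotate-≢ : ∀ {n} {s t : Fin (suc n)} → s ≢ t → rotate s ≢ rotate t
rotate-≢ {s = zero}  {zero}  0≢0 = contradiction refl 0≢0
rotate-≢ {s = zero}  {suc t} _   = ℕ.<⇒≢ (toℕ<n t) ∘ sym
rotate-≢ {s = suc s} {zero}  _   = ℕ.<⇒≢ (toℕ<n s)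
rotate-≢ {s = suc _} {suc _} s≢t = toℕ-≢ (s≢t ∘ cong suc)

⊓-collision : ∀ {x y n} → x ℕ.⊓ n ≡ y ℕ.⊓ n → x ≢ y → n ≤ x × n ≤ y
⊓-collision {n = n} eq x≢y = reaches eq x≢y , reaches (sym eq) (x≢y ∘ sym)
  where
  ⊓-below : ∀ {z} → ¬ n ≤ z → z ℕ.⊓ n ≡ z
  ⊓-below = ℕ.m≤n⇒m⊓n≡m ∘ ℕ.<⇒≤ ∘ ℕ.≰⇒>
  reaches : ∀ {x y} → x ℕ.⊓ n ≡ y ℕ.⊓ n → x ≢ y → n ≤ x
  reaches {x} {y} eq x≢y with n ℕ.≤? x | n ℕ.≤? y
  ... | yes n≤x | _       = n≤x
  ... | no  n≰x | yes n≤y =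
    contradiction (trans (sym (⊓-below n≰x)) (trans eq (ℕ.m≥n⇒m⊓n≡n n≤y))) (ℕ.<⇒≢ (ℕ.≰⇒> n≰x))
  ... | no  n≰x | no  n≰y = contradiction (trans (sym (⊓-below n≰x)) (trans eq (⊓-below n≰y))) x≢y

pred-collision : ∀ {x y} → ℕ.pred x ≡ ℕ.pred y → x ≢ y → x < 2 × y < 2
pred-collision {zero}        {zero}        _  0≢0 = contradiction refl 0≢0
pred-collision {zero}        {suc zero}    _  _   = ℕ.z<s , ℕ.n<1+n 1
pred-collision {suc zero}    {zero}        _  _   = ℕ.n<1+n 1 , ℕ.z<s
pred-collision {suc zero}    {suc zero}    _  1≢1 = contradiction refl 1≢1
pred-collision {suc (suc _)} {suc _}       eq ne  = contradiction (cong suc eq) ne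
pred-collision {suc _}       {suc (suc _)} eq ne  = contradiction (cong suc eq) ne

module _ {p : ℕ} where
  open DecOrder (core p) using (_∥_)

  D∦X₀ : ∀ {s} → ¬ D s ∥ X zero
  D∦X₀ (_ , X₀⋠D) = X₀⋠D X₀≤D

  X∦X₀ : ∀ {s} → ¬ X s ∥ X zero
  X∦X₀ (_ , X₀⋠X) = X₀⋠X (X≤X z≤n)

  E∦X⊤ : ∀ {s} → ¬ E s ∥ X top
  E∦X⊤ (E⋠X⊤ , _) = E⋠X⊤ E≤X⊤

  X∦X⊤ : ∀ {s} → ¬ X s ∥ X top
  X∦X⊤ {s} (X⋠X⊤ , _) = X⋠X⊤ (X≤X (Fin.≤fromℕ s))

  Y∦Y : ∀ {s t} → ¬ Y s ∥ Y t
  Y∦Y = monotone-comparable {P = core p} Y Y≤Y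

  D∦D : ∀ {s t} → ¬ D s ∥ D t
  D∦D = monotone-comparable {P = core p} D D≤D

  rotate-zero≢ : ∀ {s : Fin (suc p)} → rotate (zero {2 + p}) ≢ toℕ s
  rotate-zero≢ = ℕ.<⇒≢ (ℕ.m≤n⇒m≤o+n 1 (toℕ<n _)) ∘ sym

  ≢rotate-top : ∀ {v} → v < 1 + p → v ≢ rotate (top {p})
  ≢rotate-top {v} v<1+p = ℕ.<⇒≢ (subst (v <_) (sym (toℕ-fromℕ (suc p))) v<1+p)

  toℕ<top : ∀ {s : Fin (3 + p)} → s ≢ top → toℕ s < 2 + p
  toℕ<top {s} s≢top =
    ℕ.≤∧≢⇒< (ℕ.s≤s⁻¹ (toℕ<n s)) (s≢top ∘ toℕ-injective ∘ (λ eq → trans eq (sym toℕ-top)))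

  near-top-ranking : ∀ {c} → Ranking (core p) (_∥ X top) c 2
  near-top-ranking .rank (Y _) = 1
  near-top-ranking .rank _     = 0
  near-top-ranking .rank-< {E _} E∥X⊤ = ⊥-elim (E∦X⊤ E∥X⊤)
  near-top-ranking .rank-< {D _} _    = s≤s z≤n
  near-top-ranking .rank-< {Y _} _    = s≤s (s≤s z≤n)
  near-top-ranking .rank-< {X _} X∥X⊤ = ⊥-elim (X∦X⊤ X∥X⊤)
  near-top-ranking .rank-injective {E _} E∥X⊤ _ = ⊥-elim (E∦X⊤ E∥X⊤)
  near-top-ranking .rank-injective {X _} X∥X⊤ _ = ⊥-elim (X∦X⊤ X∥X⊤)
  near-top-ranking .rank-injective {_} {E _} _ E∥X⊤ = ⊥-elim (E∦X⊤ E∥X⊤)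
  near-top-ranking .rank-injective {_} {X _} _ X∥X⊤ = ⊥-elim (X∦X⊤ X∥X⊤)
  near-top-ranking .rank-injective {D _} {D _} _ _ D∥D _ = ⊥-elim (D∦D D∥D)
  near-top-ranking .rank-injective {Y _} {Y _} _ _ Y∥Y _ = ⊥-elim (Y∦Y Y∥Y)
  near-top-ranking .rank-injective {D _} {Y _} _ _ _ _ ()
  near-top-ranking .rank-injective {Y _} {D _} _ _ _ _ ()

module _ {p : ℕ} {Q : DecOrder} where
  open DecOrder (core p ⊕ Q) using (Carrier; _∥_)

  IsY : Carrier → Set
  IsY a = ∃ λ s → a ≡ inj₁ (Y s)

  ∥-core : ∀ {x y} → inj₁ x ∥ inj₁ y → DecOrder._∥_ (core p) x y
  ∥-core = ∥-inj₁ {P = core p} {Q = Q}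

  Y-comparable : ∀ {a b} → IsY a → IsY b → ¬ a ∥ b
  Y-comparable (_ , refl) (_ , refl) = Y∦Y ∘ ∥-core

  module _ (colourable : Colourable Q p) where
    open Colourable colourable renaming (colour to κ; colour-< to κ<p; proper to κ-proper)

    core⊕-spoiler-X : ∀ s₀ → Spoiler (core p ⊕ Q) (3 + p) (inj₁ (X s₀))
    core⊕-spoiler-X s₀ =
      ranked-spoiler {P = core p ⊕ Q} (⊕-properOff-inj₁ core-proper κ-proper)
        (colour-ranking colour-<)
      where
      c : Core p → ℕ
      c = paint toℕ (suc ∘ toℕ) toℕ (skip s₀)
      core-proper : IsProperOff (core p) (X s₀) c
      core-proper = paint-properOn (λ _ _ → toℕ-≢) (λ _ _ s≢t → toℕ-≢ s≢t ∘ ℕ.suc-injective)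
        (λ _ _ → toℕ-≢)
        (λ Xs≢ Xt≢ s≢t → s≢t ∘ skip-injective (≢-uncong X Xs≢) (≢-uncong X Xt≢))
        (λ X₀≢ _ eq → ℕ.0≢1+n (trans (sym (skip-zero (≢-uncong X X₀≢))) eq))
        (λ {s} _ X⊤≢ → ℕ.<⇒≢ (subst (toℕ s <_) (sym (skip-last (≢-uncong X X⊤≢))) (toℕ<n s)))
      colour-< : ∀ {a} → a ≢ inj₁ (X s₀) → [ c , κ ] a < 2 + p
      colour-< {inj₁ (E s)} _   = ℕ.m≤n⇒m≤o+n 1 (toℕ<n s)
      colour-< {inj₁ (D s)} _   = s≤s (toℕ<n s)
      colour-< {inj₁ (Y s)} _   = toℕ<n s
      colour-< {inj₁ (X s)} Xs≢ = skip-< (≢-uncong (λ s → inj₁ (X s)) Xs≢)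
      colour-< {inj₂ q}     _   = ℕ.m≤n⇒m≤o+n 2 (κ<p q)

    core⊕-spoiler-Y : ∀ s₀ → Spoiler (core p ⊕ Q) (3 + p) (inj₁ (Y s₀))
    core⊕-spoiler-Y s₀ = hub-spoiler {P = core p ⊕ Q} {hub = inj₁ (X zero)}
      (⊕-properOff-inj₁ core-proper κ-proper) (colour-ranking away-<) (colour-ranking near-<)
      where
      c : Core p → ℕ
      c = paint toℕ toℕ (skip s₀) rotate
      core-proper : IsProperOff (core p) (Y s₀) c
      core-proper = paint-properOn (λ _ _ → toℕ-≢) (λ _ _ → toℕ-≢)
        (λ Ys≢ Yt≢ s≢t → s≢t ∘ skip-injective (≢-uncong Y Ys≢) (≢-uncong Y Yt≢))
        (λ _ _ → rotate-≢) (λ _ _ → rotate-zero≢) (λ _ _ → ≢rotate-top (toℕ<n _))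
      away-< : ∀ {a} → a ≢ inj₁ (Y s₀) × a ≢ inj₁ (X zero) → [ c , κ ] a < 2 + p
      away-< {inj₁ (E s)}       _          = ℕ.m≤n⇒m≤o+n 1 (toℕ<n s)
      away-< {inj₁ (D s)}       _          = ℕ.m≤n⇒m≤o+n 1 (toℕ<n s)
      away-< {inj₁ (Y s)}       (Ys≢ , _)  =
        ℕ.m≤n⇒m≤o+n 1 (skip-< (≢-uncong (λ s → inj₁ (Y s)) Ys≢))
      away-< {inj₁ (X zero)}    (_ , X₀≢X₀) = contradiction refl X₀≢X₀
      away-< {inj₁ (X (suc s))} _          = toℕ<n s
      away-< {inj₂ q}           _          = ℕ.m≤n⇒m≤o+n 2 (κ<p q)
      near-< : ∀ {a} → a ≢ inj₁ (Y s₀) × a ∥ inj₁ (X zero) → [ c , κ ] a < 1 + p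
      near-< {inj₁ (E s)} _          = toℕ<n s
      near-< {inj₁ (D _)} (_ , D∥X₀) = ⊥-elim (D∦X₀ (∥-core D∥X₀))
      near-< {inj₁ (Y s)} (Ys≢ , _)  = skip-< (≢-uncong (λ s → inj₁ (Y s)) Ys≢)
      near-< {inj₁ (X _)} (_ , X∥X₀) = ⊥-elim (X∦X₀ (∥-core X∥X₀))
      near-< {inj₂ q}     _          = ℕ.m≤n⇒m≤o+n 1 (κ<p q)

    core⊕-spoiler-E : ∀ s₀ → Spoiler (core p ⊕ Q) (3 + p) (inj₁ (E s₀))
    core⊕-spoiler-E s₀ = hub-spoiler {P = core p ⊕ Q} {hub = inj₁ (X zero)}
      (⊕-properOff-inj₁ core-proper κ-proper) (colour-ranking away-<) near
      where
      c : Core p → ℕ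
      c = paint (skip s₀) toℕ toℕ rotate
      core-proper : IsProperOff (core p) (E s₀) c
      core-proper = paint-properOn
        (λ Es≢ Et≢ s≢t → s≢t ∘ skip-injective (≢-uncong E Es≢) (≢-uncong E Et≢))
        (λ _ _ → toℕ-≢) (λ _ _ → toℕ-≢) (λ _ _ → rotate-≢) (λ _ _ → rotate-zero≢)
        (λ Es≢ _ → ≢rotate-top (ℕ.m<n⇒m<1+n (skip-< (≢-uncong E Es≢))))
      away-< : ∀ {a} → a ≢ inj₁ (E s₀) × a ≢ inj₁ (X zero) → [ c , κ ] a < 2 + p
      away-< {inj₁ (E s)}       (Es≢ , _)   =
        ℕ.m≤n⇒m≤o+n 2 (skip-< (≢-uncong (λ s → inj₁ (E s)) Es≢))
      away-< {inj₁ (D s)}       _           = ℕ.m≤n⇒m≤o+n 1 (toℕ<n s)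
      away-< {inj₁ (Y s)}       _           = toℕ<n s
      away-< {inj₁ (X zero)}    (_ , X₀≢X₀) = contradiction refl X₀≢X₀
      away-< {inj₁ (X (suc s))} _           = toℕ<n s
      away-< {inj₂ q}           _           = ℕ.m≤n⇒m≤o+n 2 (κ<p q)
      large⇒Y : ∀ {a} → a ≢ inj₁ (E s₀) × a ∥ inj₁ (X zero) → p ≤ [ c , κ ] a → IsY a
      large⇒Y {inj₁ (E s)} (Es≢ , _)  p≤c =
        contradiction p≤c (ℕ.<⇒≱ (skip-< (≢-uncong (λ s → inj₁ (E s)) Es≢)))
      large⇒Y {inj₁ (D _)} (_ , D∥X₀) _   = ⊥-elim (D∦X₀ (∥-core D∥X₀))
      large⇒Y {inj₁ (Y s)} _          _   = s , refl
      large⇒Y {inj₁ (X _)} (_ , X∥X₀) _   = ⊥-elim (X∦X₀ (∥-core X∥X₀))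
      large⇒Y {inj₂ q}     _          p≤c = contradiction p≤c (ℕ.<⇒≱ (κ<p q))
      -- Truncating at p merges only colours of Y-elements, which are pairwise comparable.
      near : Ranking (core p ⊕ Q) (λ a → a ≢ inj₁ (E s₀) × a ∥ inj₁ (X zero)) [ c , κ ] (1 + p)
      near = record
        { rank           = λ a → [ c , κ ] a ℕ.⊓ p
        ; rank-<         = λ _ → s≤s (ℕ.m⊓n≤n _ p)
        ; rank-injective = λ sa sb a∥b ca≢cb eq →
            let p≤ca , p≤cb = ⊓-collision eq ca≢cb
            in  Y-comparable (large⇒Y sa p≤ca) (large⇒Y sb p≤cb) a∥b
        }

    core⊕-spoiler-D : ∀ s₀ → Spoiler (core p ⊕ Q) (3 + p) (inj₁ (D s₀))
    core⊕-spoiler-D s₀ = hub-spoiler {P = core p ⊕ Q} {hub = inj₁ (X top)}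
      (⊕-properOff-inj₁ core-proper (proper-∘ (ℕ.+-cancelˡ-≡ 2 _ _) κ-proper))
      (colour-ranking away-<) near
      where
      c : Core p → ℕ
      c = paint toℕ ((2 +_) ∘ skip s₀) toℕ toℕ
      colour : Core p ⊎ DecOrder.Carrier Q → ℕ
      colour = [ c , (2 +_) ∘ κ ]
      core-proper : IsProperOff (core p) (D s₀) c
      core-proper = paint-properOn (λ _ _ → toℕ-≢)
        (λ Ds≢ Dt≢ s≢t →
           s≢t ∘ skip-injective (≢-uncong D Ds≢) (≢-uncong D Dt≢) ∘ ℕ.+-cancelˡ-≡ 2 _ _)
        (λ _ _ → toℕ-≢) (λ _ _ → toℕ-≢) (λ _ _ ()) (λ _ _ → E≢top)
      away-< : ∀ {a} → a ≢ inj₁ (D s₀) × a ≢ inj₁ (X top) → colour a < 2 + p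
      away-< {inj₁ (E s)} _          = ℕ.m≤n⇒m≤o+n 1 (toℕ<n s)
      away-< {inj₁ (D s)} (Ds≢ , _)  = s≤s (s≤s (skip-< (≢-uncong (λ s → inj₁ (D s)) Ds≢)))
      away-< {inj₁ (Y s)} _          = toℕ<n s
      away-< {inj₁ (X s)} (_ , Xs≢)  = toℕ<top (≢-uncong (λ s → inj₁ (X s)) Xs≢)
      away-< {inj₂ q}     _          = s≤s (s≤s (κ<p q))
      small⇒Y : ∀ {a} → a ≢ inj₁ (D s₀) × a ∥ inj₁ (X top) → colour a < 2 → IsY a
      small⇒Y {inj₁ (E _)} (_ , E∥X⊤) _ = ⊥-elim (E∦X⊤ (∥-core E∥X⊤))
      small⇒Y {inj₁ (D _)} _ (s≤s (s≤s ()))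
      small⇒Y {inj₁ (Y s)} _ _ = s , refl
      small⇒Y {inj₁ (X _)} (_ , X∥X⊤) _ = ⊥-elim (X∦X⊤ (∥-core X∥X⊤))
      small⇒Y {inj₂ _}     _ (s≤s (s≤s ()))
      -- The shift by 2 leaves the colours 0 and 1 to Y alone, so pred merges only colours of
      -- Y-elements, which are pairwise comparable.
      near : Ranking (core p ⊕ Q) (λ a → a ≢ inj₁ (D s₀) × a ∥ inj₁ (X top)) colour (1 + p)
      near = record
        { rank           = ℕ.pred ∘ colour
        ; rank-<         = λ (a≢t , a∥X⊤) →
            s≤s (ℕ.pred-mono-≤ (ℕ.s≤s⁻¹ (away-< (a≢t , ∥⇒≢ {P = core p ⊕ Q} a∥X⊤))))
        ; rank-injective = λ sa sb a∥b ca≢cb eq →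
            let ca<2 , cb<2 = pred-collision eq ca≢cb
            in  Y-comparable (small⇒Y sa ca<2) (small⇒Y sb cb<2) a∥b
        }

core⊕-spoiler-inj₂ : ∀ {m Q t} → RankedSpoiler Q m t → Spoiler (core (suc m) ⊕ Q) (4 + m) (inj₂ t)
core⊕-spoiler-inj₂ {m} {Q} {t} s = hub-spoiler {P = core (suc m) ⊕ Q} {hub = inj₁ (X top)}
  (⊕-properOff-inj₂ height-proper proper) (colour-ranking away-<)
  (ranking-mono {P = core (suc m) ⊕ Q} near⊆ (⊕-ranking near-top-ranking ranking))
  where
  open RankedSpoiler s
  open DecOrder (core (suc m) ⊕ Q) using (_∥_)
  open DecOrder (core (suc m)) using () renaming (_∥_ to _∥ᶜ_)
  away-< : ∀ {a} → a ≢ inj₂ t × a ≢ inj₁ (X top) → [ height , colour ] a < 3 + m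
  away-< {inj₁ (E s)} _         = ℕ.m≤n⇒m≤o+n 1 (toℕ<n s)
  away-< {inj₁ (D s)} _         = s≤s (toℕ<n s)
  away-< {inj₁ (Y s)} _         = toℕ<n s
  away-< {inj₁ (X s)} (_ , Xs≢) = toℕ<top (≢-uncong (λ s → inj₁ (X s)) Xs≢)
  away-< {inj₂ q}     (q≢t , _) = s≤s (ℕ.m≤n⇒m≤o+n 2 (colour-≤ (≢-uncong inj₂ q≢t)))
  near⊆ : ∀ {a} → a ≢ inj₂ t × a ∥ inj₁ (X top) → [ _∥ᶜ X top , _≢ t ] a
  near⊆ {inj₁ _} (_ , x∥X⊤) = ∥-inj₁ {P = core (suc m)} {Q = Q} x∥X⊤
  near⊆ {inj₂ _} (q≢t , _)  = ≢-uncong inj₂ q≢t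

-- Minimal forcers of antichains

record MinimalForcer (P : DecOrder) (k : ℕ) : Set where
  field
    forces     : Forces P k
    critical   : Critical P k
    colourable : Colourable P k

chain⊕-minimalForcer : ∀ {P k} → MinimalForcer P k → MinimalForcer (chain (suc k) ⊕ P) (suc k)
chain⊕-minimalForcer m = record
  { forces     = chain⊕-forces forces
  ; critical   = chain⊕-critical colourable critical
  ; colourable = chain⊕-colourable colourable
  }
  where open MinimalForcer m

seed : ℕ → DecOrder
seed p = core p ⊕ chains p

seed-spoiler-inj₂ : ∀ p b → Spoiler (seed p) (3 + p) (inj₂ b)
seed-spoiler-inj₂ (suc m) b = core⊕-spoiler-inj₂ (chains-rankedSpoiler m b)

seed-minimalForcer : ∀ p → MinimalForcer (seed p) (3 + p)
seed-minimalForcer p = record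
  { forces     = ⊕-forces core-robust (chains-forces p)
  ; critical   = critical
  ; colourable = ⊕-colourable core-colourable (colourable-mono (ℕ.m≤n+m p 3) (chains-colourable p))
  }
  where
  critical : Critical (seed p) (3 + p)
  critical (inj₁ (E s)) = core⊕-spoiler-E (chains-colourable p) s
  critical (inj₁ (D s)) = core⊕-spoiler-D (chains-colourable p) s
  critical (inj₁ (Y s)) = core⊕-spoiler-Y (chains-colourable p) s
  critical (inj₁ (X s)) = core⊕-spoiler-X (chains-colourable p) s
  critical (inj₂ b) = seed-spoiler-inj₂ p b

tower : ℕ → ℕ → DecOrder
tower p zero    = seed p
tower p (suc r) = chain (suc (r + (3 + p))) ⊕ tower p r

tower-minimalForcer : ∀ p r → MinimalForcer (tower p r) (r + (3 + p))
tower-minimalForcer p zero    = seed-minimalForcer p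
tower-minimalForcer p (suc r) = chain⊕-minimalForcer (tower-minimalForcer p r)

Finite : DecOrder → ℕ → Set
Finite P n = DecOrder.Carrier P ↔ Fin n

⊎↔Fin : ∀ {A B : Set} {m n} → A ↔ Fin m → B ↔ Fin n → (A ⊎ B) ↔ Fin (m + n)
⊎↔Fin A↔m B↔n = ↔-trans (A↔m ⊎-↔ B↔n) (↔-sym +↔⊎)

triangle : ℕ → ℕ
triangle zero    = zero
triangle (suc n) = suc n + triangle n

chains-finite : ∀ n → Finite (chains n) (triangle n)
chains-finite zero    = ↔-refl
chains-finite (suc n) = ⊎↔Fin ↔-refl (chains-finite n)

core-finite : ∀ p → Finite (core p) (3 + p + (2 + p + (suc p + suc p)))
core-finite p = ↔-trans core↔⊎ (⊎↔Fin ↔-refl (⊎↔Fin ↔-refl (⊎↔Fin ↔-refl ↔-refl)))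
  where
  to : Core p → Fin (3 + p) ⊎ Fin (2 + p) ⊎ Fin (suc p) ⊎ Fin (suc p)
  to (X s) = inj₁ s
  to (Y s) = inj₂ (inj₁ s)
  to (D s) = inj₂ (inj₂ (inj₁ s))
  to (E s) = inj₂ (inj₂ (inj₂ s))
  from : Fin (3 + p) ⊎ Fin (2 + p) ⊎ Fin (suc p) ⊎ Fin (suc p) → Core p
  from = [ X , [ Y , [ D , E ] ] ]
  core↔⊎ : Core p ↔ (Fin (3 + p) ⊎ Fin (2 + p) ⊎ Fin (suc p) ⊎ Fin (suc p))
  core↔⊎ = mk↔ₛ′ to from
    (λ where
      (inj₁ _)                → refl
      (inj₂ (inj₁ _))         → refl
      (inj₂ (inj₂ (inj₁ _)))  → refl
      (inj₂ (inj₂ (inj₂ _)))  → refl)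
    (λ where
      (X _) → refl
      (Y _) → refl
      (D _) → refl
      (E _) → refl)

tower-finite : ∀ p r → Finite (tower p r) (triangle (r + (3 + p)) + suc p)
tower-finite p zero = subst (Finite (seed p)) (seed-size p (triangle p))
                            (⊎↔Fin (core-finite p) (chains-finite p))
  where
  seed-size : ∀ p t → 3 + p + (2 + p + (suc p + suc p)) + t ≡ 3 + p + (2 + p + (suc p + t)) + suc p
  seed-size = solve-∀
tower-finite p (suc r) =
  subst (Finite (tower p (suc r))) (sym (ℕ.+-assoc (suc k) (triangle k) (suc p)))
        (⊎↔Fin ↔-refl (tower-finite p r))
  where k = r + (3 + p)

module _ (P : DecOrder) {n : ℕ} (enum : Finite P n) where
  open DecOrder P
  open Inverse enum using (to; from; strictlyInverseˡ; strictlyInverseʳ)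

  from-injective : Injective _≡_ _≡_ from
  from-injective {x} {y} eq =
    trans (sym (strictlyInverseˡ x)) (trans (cong to eq) (strictlyInverseˡ y))

  to-injective : Injective _≡_ _≡_ to
  to-injective {a} {b} eq =
    trans (sym (strictlyInverseʳ a)) (trans (cong from eq) (strictlyInverseʳ b))

  toFinPoset : FinPoset n
  toFinPoset = record
    { le        = λ x y → ⌊ from x ≼? from y ⌋
    ; reflexive = λ _ → fromWitness ≼-refl
    ; antisym   = λ _ _ x≤y y≤x → from-injective (≼-antisym (toWitness x≤y) (toWitness y≤x))
    ; trans′    = λ _ _ _ x≤y y≤z → fromWitness (≼-trans (toWitness x≤y) (toWitness y≤z))
    }

  le-to : ∀ a b → le toFinPoset (to a) (to b) ≡ ⌊ a ≼? b ⌋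
  le-to a b = cong₂ (λ u v → ⌊ u ≼? v ⌋) (strictlyInverseʳ a) (strictlyInverseʳ b)

  forces⇒rainbowForces : ∀ {k} → Forces P k → RainbowForces toFinPoset (antichain k)
  forces⇒rainbowForces forces c c-proper = copy , λ _ _ → colourful rainbow
    where
    proper : IsProper P (c ∘ to)
    proper .separates _ _ a≢b a≼b =
      c-proper _ _ (a≢b ∘ to-injective) (subst T (sym (le-to _ _)) (fromWitness a≼b))
    g = proj₁ (forces (c ∘ to) proper)
    rainbow = proj₂ (forces (c ∘ to) proper)
    copy : Copy (antichain _) toFinPoset
    copy = record { map = to ∘ g ; injective = injective′ ; order = order′ }
      where
      injective′ : ∀ x y → to (g x) ≡ to (g y) → x ≡ y
      injective′ x y eq with x Fin.≟ y
      ... | yes x≡y = x≡y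
      ... | no x≢y  = contradiction (cong c eq) (colourful rainbow x≢y)
      order′ : ∀ x y → ⌊ x Fin.≟ y ⌋ ≡ le toFinPoset (to (g x)) (to (g y))
      order′ x y rewrite le-to (g x) (g y) with x Fin.≟ y
      ... | yes refl = sym (⌊≼?⌋≡true {P = P} ≼-refl)
      ... | no x≢y   = sym (⌊≼?⌋≡false {P = P} (incomparable rainbow x≢y))

module _ (P : DecOrder) {m : ℕ} (enum : Finite P (suc m)) where
  open DecOrder P
  open Inverse enum using (from)

  critical⇒¬deletionForces : ∀ {k} → Critical P k → ∀ q →
                              ¬ RainbowForces (delete (toFinPoset P enum) q) (antichain k)
  critical⇒¬deletionForces {k} critical q forces = no-rainbow g g≢t rainbow
    where
    open Spoiler (critical (from q))
    punched : Fin m → Carrier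
    punched x = from (punchIn q x)
    punched≢t : ∀ x → punched x ≢ from q
    punched≢t x = punchInᵢ≢i q x ∘ from-injective P enum
    c : Fin m → ℕ
    c = colour ∘ punched
    c-proper : Proper (delete (toFinPoset P enum) q) c
    c-proper x y x≢y x≤y = separates proper (punched≢t x) (punched≢t y)
      (x≢y ∘ punchIn-injective q x y ∘ from-injective P enum) (toWitness x≤y)
    C = proj₁ (forces c c-proper)
    g : Fin k → Carrier
    g = punched ∘ map C
    g≢t : ∀ i → g i ≢ from q
    g≢t i = punched≢t (map C i)
    rainbow : RainbowAntichain P colour g
    rainbow = record { incomparable = incomparable′ ; colourful = proj₂ (forces c c-proper) _ _ }
      where
      incomparable′ : ∀ {i j} → i ≢ j → ¬ g i ≼ g j
      incomparable′ {i} {j} i≢j gi≼gj with i Fin.≟ j | order C i j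
      ... | yes i≡j | _  = i≢j i≡j
      ... | no _    | eq = contradiction (trans eq (⌊≼?⌋≡true {P = P} gi≼gj)) λ ()

minimalForcer⇒InM : ∀ {P k m} → MinimalForcer P k → (enum : Finite P (suc m)) →
                    InM (antichain k) (suc m , toFinPoset P enum)
minimalForcer⇒InM {P} mf enum =
  forces⇒rainbowForces P enum forces , critical⇒¬deletionForces P enum critical
  where open MinimalForcer mf

Iso⇒≡ : ∀ P Q → Iso P Q → proj₁ P ≡ proj₁ Q
Iso⇒≡ (_ , _) (_ , _) (f , g , g∘f , f∘g , _) =
  Fin.cantor-schröder-bernstein (λ eq → trans (sym (g∘f _)) (trans (cong g eq) (g∘f _)))
                                (λ eq → trans (sym (f∘g _)) (trans (cong f eq) (f∘g _)))

module _ {k p : ℕ} (3+p≤k : 3 + p ≤ k) where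
  private
    r : ℕ
    r = k ∸ (3 + p)
    r+3+p≡k : r + (3 + p) ≡ k
    r+3+p≡k = ℕ.m∸n+n≡m 3+p≤k

    enum : Finite (tower p r) (suc (triangle k + p))
    enum = subst (Finite (tower p r))
                 (trans (cong (λ k → triangle k + suc p) r+3+p≡k) (ℕ.+-suc _ p))
                 (tower-finite p r)

  member : Poset
  member = suc (triangle k + p) , toFinPoset (tower p r) enum

  member-InM : InM (antichain k) member
  member-InM =
    minimalForcer⇒InM (subst (MinimalForcer (tower p r)) r+3+p≡k (tower-minimalForcer p r)) enum

proposition2p7 : (N : ℕ) → Σ ℕ λ K → (k : ℕ) → K ≤ k → AtLeast N (InM (antichain k))
proposition2p7 N = 2 + N , members
  where
  members : ∀ k → 2 + N ≤ k → AtLeast N (InM (antichain k))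
  members k 2+N≤k = M , (λ i → member-InM (fits i)) , λ i j i≢j iso →
    i≢j (toℕ-injective (ℕ.+-cancelˡ-≡ (triangle k) _ _ (ℕ.suc-injective (Iso⇒≡ (M i) (M j) iso))))
    where
    fits : (i : Fin N) → 3 + toℕ i ≤ k
    fits i = ℕ.≤-trans (s≤s (s≤s (toℕ<n i))) 2+N≤k
    M : Fin N → Poset
    M i = member (fits i)
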